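{- For every positive integer $n$, the set $B_{n+1}(231,321)$ is in bijection with $S_n(231,321)$; in particular $|B_{n+1}(231,321)|=|S_n(231,321)|$.
   Context: A permutation $\sigma\in S_n$ is written as $\sigma(1)\cdots\sigma(n)$. An index $i\in[n-1]$ is an ascent if $\sigma(i)<\sigma(i+1)$ and a descent if $\sigma(i)>\sigma(i+1)$. A ballot permutation is a permutation such that every prefix $\sigma(1)\cdots\sigma(p)$ has at least as many ascents as descents. $\sigma$ contains a pattern $\pi\in S_k$ if some subsequence $\sigma(c_1)\cdots\sigma(c_k)$ with $c_1<\dots<c_k$ is order-isomorphic to $\pi$, and avoids $\pi$ otherwise. $S_n(\pi_1,\dots,\pi_m)$ denotes the set of permutations of $[n]$ avoiding all of $\pi_1,\dots,\pi_m$, and $B_n(\pi_1,\dots,\pi_m)$ the set of ballot permutations of length $n$ avoiding all of them. -}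

module Defs where

open import Data.Nat using (ℕ; zero; suc; _+_; _≤_; _<_)
open import Data.Nat.Properties using (_<?_)
open import Data.Fin using (Fin; toℕ; fromℕ<)
open import Data.Fin.Permutation using (Permutation′; _⟨$⟩ʳ_)
open import Data.Product using (Σ; _×_; _,_; ∃)
open import Data.List using (List; []; _∷_; filter; length; upTo)
open import Relation.Nullary using (¬_; does)
open import Data.Bool using (true; false)
open import Function.Bundles using (_⇔_)

-- Values of a permutation as natural numbers, 0-indexed positions.
-- σ(i) for i : ℕ, with out-of-range indices mapped to 0 (never used in range).
val : ∀ {n} → Permutation′ n → ℕ → ℕ
val {n} σ i with i <? n
... | Relation.Nullary.yes i<n = toℕ (σ ⟨$⟩ʳ fromℕ< i<n)
... | Relation.Nullary.no _ = 0

-- number of ascents (resp. descents) at 0-indexed positions i with i + 1 < p,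
-- i.e. within the prefix σ(1)⋯σ(p) (1-indexed).
ascentsUpTo : ∀ {n} → Permutation′ n → ℕ → ℕ
ascentsUpTo σ p = length (filter (λ i → val σ i <? val σ (suc i))
                          (filter (λ i → suc i <? p) (upTo p)))

descentsUpTo : ∀ {n} → Permutation′ n → ℕ → ℕ
descentsUpTo σ p = length (filter (λ i → val σ (suc i) <? val σ i)
                          (filter (λ i → suc i <? p) (upTo p)))

IsBallot : ∀ {n} → Permutation′ n → Set
IsBallot {n} σ = ∀ p → p ≤ n → descentsUpTo σ p ≤ ascentsUpTo σ p

Contains : ∀ {n k} → Permutation′ n → Permutation′ k → Set
Contains {n} {k} σ π =
  Σ (Fin k → Fin n) λ c →
    (∀ i j → toℕ i < toℕ j → toℕ (c i) < toℕ (c j)) ×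
    (∀ i j → (toℕ (π ⟨$⟩ʳ i) < toℕ (π ⟨$⟩ʳ j)) ⇔ (toℕ (σ ⟨$⟩ʳ c i) < toℕ (σ ⟨$⟩ʳ c j)))

Avoids : ∀ {n k} → Permutation′ n → Permutation′ k → Set
Avoids σ π = ¬ Contains σ π

open import Data.Fin.Permutation using (permutation)
open import Data.Fin using (zero; suc)
open import Relation.Binary.PropositionalEquality using (_≡_; refl)

-- the pattern 231 (0-indexed values: 1 2 0)
p231f p231g : Fin 3 → Fin 3
p231f zero = suc zero
p231f (suc zero) = suc (suc zero)
p231f (suc (suc zero)) = zero
p231g zero = suc (suc zero)
p231g (suc zero) = zero
p231g (suc (suc zero)) = suc zero

-- the pattern 321 (0-indexed values: 2 1 0), an involution
p321f : Fin 3 → Fin 3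
p321f zero = suc (suc zero)
p321f (suc zero) = suc zero
p321f (suc (suc zero)) = zero

p231 : Permutation′ 3
p231 = permutation p231f p231g
  (λ { zero → refl ; (suc zero) → refl ; (suc (suc zero)) → refl })
  (λ { zero → refl ; (suc zero) → refl ; (suc (suc zero)) → refl })

p321 : Permutation′ 3
p321 = permutation p321f p321f
  (λ { zero → refl ; (suc zero) → refl ; (suc (suc zero)) → refl })
  (λ { zero → refl ; (suc zero) → refl ; (suc (suc zero)) → refl })

S-231-321 : ℕ → Set
S-231-321 n = Σ (Permutation′ n) λ σ → Avoids σ p231 × Avoids σ p321

B-231-321 : ℕ → Set
B-231-321 n = Σ (Permutation′ n) λ σ → IsBallot σ × (Avoids σ p231 × Avoids σ p321)

open import Data.Product using (proj₁)

-- Two elements of such a set are identified when their underlying permutations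
-- agree pointwise (avoidance/ballot proofs are irrelevant evidence).
_≈ₚ_ : ∀ {n} {P : Permutation′ n → Set} → Σ (Permutation′ n) P → Σ (Permutation′ n) P → Set
x ≈ₚ y = ∀ i → proj₁ x ⟨$⟩ʳ i ≡ proj₁ y ⟨$⟩ʳ i

record Bijection {m n} (P : Permutation′ m → Set) (Q : Permutation′ n → Set) : Set where
  field
    to       : Σ (Permutation′ m) P → Σ (Permutation′ n) Q
    from     : Σ (Permutation′ n) Q → Σ (Permutation′ m) P
    to-cong  : ∀ {x y} → x ≈ₚ y → to x ≈ₚ to y
    from-cong : ∀ {x y} → x ≈ₚ y → from x ≈ₚ from y
    from∘to  : ∀ x → from (to x) ≈ₚ x
    to∘from  : ∀ y → to (from y) ≈ₚ y

-- A ballot permutation starts with an ascent, and a 231-avoider that starts with an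
-- ascent σ(1) < σ(2) must have σ(1) = 1: otherwise the entry 1 sits at a later
-- position j and σ(1) σ(2) σ(j) is an occurrence of 231.  Deleting this initial
-- minimum therefore maps B_{n+1}(231,321) into S_n(231,321), and prepending a new
-- minimum is its inverse.  The only thing to check for the inverse is the ballot
-- condition: in a 321-avoider every descent at position i+1 is preceded by an
-- ascent at position i, so shifting descents one step to the left injects them into
-- the ascents of each prefix.

module Submission where

open import Level using (Level)
open import Data.Nat using (ℕ; zero; suc; _≤_; _<_; z≤n; s≤s; s<s⁻¹)
open import Data.Nat.Properties
  using (_<?_; ≤-refl; ≤-trans; <-trans; <-irrefl; <-asym; <-cmp; n≤1+n; m≤n⇒m≤1+n;
         n≮0; n≢0⇒n>0; <-irrelevant; module ≤-Reasoning)
open import Data.List using ([]; [_]; _++_; filter; length; applyUpTo; upTo)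
open import Data.List.Properties using (upTo-∷ʳ; filter-++; filter-all; filter-reject; ++-identityʳ)
open import Data.List.Relation.Unary.All.Properties using (applyUpTo⁺₁)
open import Data.Fin using (Fin; toℕ; fromℕ<; punchOut)
open import Data.Fin.Patterns using (0F; 1F; 2F)
open import Data.Fin.Properties using (toℕ-fromℕ<; fromℕ<-toℕ; toℕ-injective; toℕ<n; punchIn-punchOut; suc-injective)
open import Data.Fin.Permutation
  using (Permutation′; _⟨$⟩ʳ_; _⟨$⟩ˡ_; _≈_; inverseˡ; inverseʳ; remove; lift₀; lift₀-remove; lift₀-cong)
open import Data.Product using (_×_; _,_; proj₁)
open import Data.Empty using (⊥-elim)
open import Function.Base using (case_of_)
open import Function.Bundles using (mk⇔; Equivalence)
open import Relation.Nullary using (¬_; yes; no)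
open import Relation.Unary using (Pred; Decidable)
open import Relation.Binary.Definitions using (tri<; tri≈; tri>)
open import Relation.Binary.PropositionalEquality
  using (_≡_; _≢_; refl; sym; trans; cong; cong₂; subst; subst₂; module ≡-Reasoning)

open import Defs

private
  variable
    ℓ : Level
    A : Set
    m n k : ℕ

count : {P : Pred ℕ ℓ} → Decidable P → ℕ → ℕ
count P? zero = 0
count P? (suc k) with P? 0
... | yes _ = suc (count (λ i → P? (suc i)) k)
... | no _ = count (λ i → P? (suc i)) k

count-mono : {P : Pred ℕ ℓ} (P? : Decidable P) {k l : ℕ} → k ≤ l → count P? k ≤ count P? l
count-mono P? z≤n = z≤n
count-mono P? (s≤s k≤l) with P? 0
... | yes _ = s≤s (count-mono (λ i → P? (suc i)) k≤l)
... | no _ = count-mono (λ i → P? (suc i)) k≤l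

count-implies : {P Q : Pred ℕ ℓ} (P? : Decidable P) (Q? : Decidable Q) (k : ℕ) →
  (∀ i → i < k → P i → Q i) → count P? k ≤ count Q? k
count-implies P? Q? zero P⇒Q = z≤n
count-implies P? Q? (suc k) P⇒Q
  with P? 0 | Q? 0 | count-implies (λ i → P? (suc i)) (λ i → Q? (suc i)) k (λ i i<k → P⇒Q (suc i) (s≤s i<k))
... | yes _ | yes _ | ih = s≤s ih
... | yes p | no ¬q | _  = ⊥-elim (¬q (P⇒Q 0 (s≤s z≤n) p))
... | no _  | yes _ | ih = m≤n⇒m≤1+n ih
... | no _  | no _  | ih = ih

count-one : {P Q : Pred ℕ ℓ} (P? : Decidable P) (Q? : Decidable Q) → count P? 1 ≤ count Q? 1 → P 0 → Q 0
count-one P? Q? le p with P? 0 | Q? 0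
... | no ¬p | _     = ⊥-elim (¬p p)
... | yes _ | yes q = q
... | yes _ | no _  = ⊥-elim (n≮0 le)

length-filter-applyUpTo : {P : Pred A ℓ} (P? : Decidable P) (f : ℕ → A) (k : ℕ) →
  length (filter P? (applyUpTo f k)) ≡ count (λ i → P? (f i)) k
length-filter-applyUpTo P? f zero = refl
length-filter-applyUpTo P? f (suc k) with P? (f 0)
... | yes _ = cong suc (length-filter-applyUpTo P? (λ i → f (suc i)) k)
... | no _ = length-filter-applyUpTo P? (λ i → f (suc i)) k

filter-suc<-upTo : (q : ℕ) → filter (λ i → suc i <? suc q) (upTo (suc q)) ≡ upTo q
filter-suc<-upTo q = begin
  filter (λ i → suc i <? suc q) (upTo (suc q))
    ≡⟨ cong (filter (λ i → suc i <? suc q)) (sym (upTo-∷ʳ q)) ⟩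
  filter (λ i → suc i <? suc q) (upTo q ++ [ q ])
    ≡⟨ filter-++ (λ i → suc i <? suc q) (upTo q) [ q ] ⟩
  filter (λ i → suc i <? suc q) (upTo q) ++ filter (λ i → suc i <? suc q) [ q ]
    ≡⟨ cong₂ _++_ (filter-all (λ i → suc i <? suc q) (applyUpTo⁺₁ (λ i → i) q s≤s))
                  (filter-reject (λ i → suc i <? suc q) (<-irrefl refl)) ⟩
  upTo q ++ []
    ≡⟨ ++-identityʳ (upTo q) ⟩
  upTo q ∎
  where open ≡-Reasoning

ascent? : (f : ℕ → ℕ) → Decidable (λ i → f i < f (suc i))
ascent? f i = f i <? f (suc i)

descent? : (f : ℕ → ℕ) → Decidable (λ i → f (suc i) < f i)
descent? f i = f (suc i) <? f i

descents-≤-ascents : (f : ℕ → ℕ) (q : ℕ) → ¬ f 1 < f 0 →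
  (∀ i → suc i < q → f (suc (suc i)) < f (suc i) → f i < f (suc i)) →
  count (descent? f) q ≤ count (ascent? f) q
descents-≤-ascents f zero no-first-descent descent⇒ascent = z≤n
descents-≤-ascents f (suc r) no-first-descent descent⇒ascent with descent? f 0
... | yes d = ⊥-elim (no-first-descent d)
... | no _ = begin
  count (λ i → descent? f (suc i)) r
    ≤⟨ count-implies _ (ascent? f) r (λ i i<r → descent⇒ascent i (s≤s i<r)) ⟩
  count (ascent? f) r
    ≤⟨ count-mono (ascent? f) (n≤1+n r) ⟩
  count (ascent? f) (suc r) ∎
  where open ≤-Reasoning

ascentsUpTo-suc : (σ : Permutation′ m) (q : ℕ) → ascentsUpTo σ (suc q) ≡ count (ascent? (val σ)) q
ascentsUpTo-suc σ q = trans (cong (λ l → length (filter (ascent? (val σ)) l)) (filter-suc<-upTo q))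
                            (length-filter-applyUpTo (ascent? (val σ)) (λ i → i) q)

descentsUpTo-suc : (σ : Permutation′ m) (q : ℕ) → descentsUpTo σ (suc q) ≡ count (descent? (val σ)) q
descentsUpTo-suc σ q = trans (cong (λ l → length (filter (descent? (val σ)) l)) (filter-suc<-upTo q))
                             (length-filter-applyUpTo (descent? (val σ)) (λ i → i) q)

ballot-criterion : (σ : Permutation′ m) → ¬ val σ 1 < val σ 0 →
  (∀ i → suc (suc i) < m → val σ (suc (suc i)) < val σ (suc i) → val σ i < val σ (suc i)) →
  IsBallot σ
ballot-criterion σ no-first-descent descent⇒ascent zero _ = z≤n
ballot-criterion σ no-first-descent descent⇒ascent (suc q) q<m =
  subst₂ _≤_ (sym (descentsUpTo-suc σ q)) (sym (ascentsUpTo-suc σ q))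
    (descents-≤-ascents (val σ) q no-first-descent
      (λ i i<q → descent⇒ascent i (≤-trans (s≤s i<q) q<m)))

value : Permutation′ m → Fin m → ℕ
value σ x = toℕ (σ ⟨$⟩ʳ x)

value-injective : (σ : Permutation′ m) {x y : Fin m} → value σ x ≡ value σ y → x ≡ y
value-injective σ {x} {y} e = begin
  x                          ≡⟨ sym (inverseˡ σ) ⟩
  σ ⟨$⟩ˡ (σ ⟨$⟩ʳ x)          ≡⟨ cong (σ ⟨$⟩ˡ_) (toℕ-injective e) ⟩
  σ ⟨$⟩ˡ (σ ⟨$⟩ʳ y)          ≡⟨ inverseˡ σ ⟩
  y                          ∎
  where open ≡-Reasoning

value-≯⇒< : (σ : Permutation′ m) {x y : Fin m} → x ≢ y → ¬ value σ y < value σ x → value σ x < value σ y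
value-≯⇒< σ x≢y ≯ with <-cmp (value σ _) (value σ _)
... | tri< < _ _ = <
... | tri≈ _ e _ = ⊥-elim (x≢y (value-injective σ e))
... | tri> _ _ > = ⊥-elim (≯ >)

val-fromℕ< : (σ : Permutation′ m) {i : ℕ} (i<m : i < m) → val σ i ≡ value σ (fromℕ< i<m)
val-fromℕ< {m} σ {i} i<m with i <? m
... | yes i<m′ = cong (λ p → value σ (fromℕ< p)) (<-irrelevant i<m′ i<m)
... | no i≮m = ⊥-elim (i≮m i<m)

val-toℕ : (σ : Permutation′ m) (x : Fin m) → val σ (toℕ x) ≡ value σ x
val-toℕ σ x = trans (val-fromℕ< σ (toℕ<n x)) (cong (value σ) (fromℕ<-toℕ x (toℕ<n x)))

ballot⇒first-ascent : (σ : Permutation′ (suc (suc n))) → IsBallot σ → value σ 0F < value σ 1F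
ballot⇒first-ascent σ ballot = value-≯⇒< σ (λ ()) no-first-descent
  where
  prefix₂ : count (descent? (val σ)) 1 ≤ count (ascent? (val σ)) 1
  prefix₂ = subst₂ _≤_ (descentsUpTo-suc σ 1) (ascentsUpTo-suc σ 1) (ballot 2 (s≤s (s≤s z≤n)))
  no-first-descent : ¬ value σ 1F < value σ 0F
  no-first-descent desc = <-asym desc (subst₂ _<_ (val-toℕ σ 0F) (val-toℕ σ 1F)
    (count-one (descent? (val σ)) (ascent? (val σ)) prefix₂
      (subst₂ _<_ (sym (val-toℕ σ 1F)) (sym (val-toℕ σ 0F)) desc)))

contains-of-order : (σ : Permutation′ m) (π : Permutation′ k) (c : Fin k → Fin m) →
  (∀ i j → toℕ i < toℕ j → toℕ (c i) < toℕ (c j)) →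
  (∀ i j → value π i < value π j → value σ (c i) < value σ (c j)) →
  Contains σ π
contains-of-order σ π c increasing order = c , increasing , λ i j → mk⇔ (order i j) (reflect i j)
  where
  reflect : ∀ i j → value σ (c i) < value σ (c j) → value π i < value π j
  reflect i j σ< with <-cmp (value π i) (value π j)
  ... | tri< π< _ _ = π<
  ... | tri≈ _ e _ = ⊥-elim (<-irrefl (cong (λ x → value σ (c x)) (value-injective π e)) σ<)
  ... | tri> _ _ π> = ⊥-elim (<-asym σ< (order j i π>))

contains-resp-≈ : {ρ σ : Permutation′ m} {π : Permutation′ k} → ρ ≈ σ → Contains ρ π → Contains σ π
contains-resp-≈ {σ = σ} {π} ρ≈σ (c , increasing , iso) =
  contains-of-order σ π c increasing λ i j π< →
    subst₂ _<_ (cong toℕ (ρ≈σ (c i))) (cong toℕ (ρ≈σ (c j))) (Equivalence.to (iso i j) π<)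

triple : Fin m → Fin m → Fin m → Fin 3 → Fin m
triple a b d 0F = a
triple a b d 1F = b
triple a b d 2F = d

triple-increasing : (a b d : Fin m) → toℕ a < toℕ b → toℕ b < toℕ d →
  ∀ i j → toℕ i < toℕ j → toℕ (triple a b d i) < toℕ (triple a b d j)
triple-increasing a b d a<b b<d 0F 1F _ = a<b
triple-increasing a b d a<b b<d 0F 2F _ = <-trans a<b b<d
triple-increasing a b d a<b b<d 1F 2F _ = b<d
triple-increasing a b d a<b b<d 0F 0F ()
triple-increasing a b d a<b b<d 1F 0F ()
triple-increasing a b d a<b b<d 1F 1F (s≤s ())
triple-increasing a b d a<b b<d 2F 0F ()
triple-increasing a b d a<b b<d 2F 1F (s≤s ())
triple-increasing a b d a<b b<d 2F 2F (s≤s (s≤s ()))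

module _ (σ : Permutation′ m) {a b d : Fin m} (a<b : toℕ a < toℕ b) (b<d : toℕ b < toℕ d) where

  contains-321 : value σ b < value σ a → value σ d < value σ b → Contains σ p321
  contains-321 σb<σa σd<σb =
    contains-of-order σ p321 (triple a b d) (triple-increasing a b d a<b b<d) order
    where
    order : ∀ i j → value p321 i < value p321 j → value σ (triple a b d i) < value σ (triple a b d j)
    order 1F 0F _ = σb<σa
    order 2F 0F _ = <-trans σd<σb σb<σa
    order 2F 1F _ = σd<σb
    order 0F 0F (s≤s (s≤s ()))
    order 0F 1F (s≤s ())
    order 0F 2F ()
    order 1F 1F (s≤s ())
    order 1F 2F ()
    order 2F 2F ()

  contains-231 : value σ a < value σ b → value σ d < value σ a → Contains σ p231
  contains-231 σa<σb σd<σa =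
    contains-of-order σ p231 (triple a b d) (triple-increasing a b d a<b b<d) order
    where
    order : ∀ i j → value p231 i < value p231 j → value σ (triple a b d i) < value σ (triple a b d j)
    order 0F 1F _ = σa<σb
    order 2F 0F _ = σd<σa
    order 2F 1F _ = <-trans σd<σa σa<σb
    order 0F 0F (s≤s ())
    order 0F 2F ()
    order 1F 0F (s≤s ())
    order 1F 1F (s≤s (s≤s ()))
    order 1F 2F ()
    order 2F 2F ()

descent⇒ascent-of-321-avoider : (σ : Permutation′ m) → Avoids σ p321 →
  ∀ i → suc (suc i) < m → val σ (suc (suc i)) < val σ (suc i) → val σ i < val σ (suc i)
descent⇒ascent-of-321-avoider {m} σ avoids i i+2<m desc =
  subst₂ _<_ (sym (val-fromℕ< σ i<m)) (sym (val-fromℕ< σ i+1<m)) ascent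
  where
  i+1<m = ≤-trans (n≤1+n (suc (suc i))) i+2<m
  i<m = ≤-trans (n≤1+n (suc i)) i+1<m
  a = fromℕ< i<m
  b = fromℕ< i+1<m
  d = fromℕ< i+2<m
  a<b : toℕ a < toℕ b
  a<b = subst₂ _<_ (sym (toℕ-fromℕ< i<m)) (sym (toℕ-fromℕ< i+1<m)) ≤-refl
  b<d : toℕ b < toℕ d
  b<d = subst₂ _<_ (sym (toℕ-fromℕ< i+1<m)) (sym (toℕ-fromℕ< i+2<m)) ≤-refl
  ascent : value σ a < value σ b
  ascent = value-≯⇒< σ (λ a≡b → <-irrefl (cong toℕ a≡b) a<b) λ σb<σa →
    avoids (contains-321 σ a<b b<d σb<σa (subst₂ _<_ (val-fromℕ< σ i+2<m) (val-fromℕ< σ i+1<m) desc))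

first-ascent-231-avoider-starts-at-0 : (σ : Permutation′ (suc (suc n))) →
  value σ 0F < value σ 1F → Avoids σ p231 → σ ⟨$⟩ʳ 0F ≡ 0F
first-ascent-231-avoider-starts-at-0 σ σ0<σ1 avoids = position-of-0 (σ ⟨$⟩ˡ 0F) (inverseʳ σ)
  where
  position-of-0 : ∀ j → σ ⟨$⟩ʳ j ≡ 0F → σ ⟨$⟩ʳ 0F ≡ 0F
  position-of-0 0F σ0≡0 = σ0≡0
  position-of-0 1F σ1≡0 = ⊥-elim (n≮0 (subst (value σ 0F <_) (cong toℕ σ1≡0) σ0<σ1))
  position-of-0 (Fin.suc (Fin.suc j)) σj≡0 =
    ⊥-elim (avoids (contains-231 σ (s≤s z≤n) (s≤s (s≤s z≤n)) σ0<σ1 σj<σ0))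
    where
    σj<σ0 : value σ (Fin.suc (Fin.suc j)) < value σ 0F
    σj<σ0 = subst (_< value σ 0F) (sym (cong toℕ σj≡0)) (n≢0⇒n>0 λ σ0≡0 →
      case value-injective σ (trans σ0≡0 (sym (cong toℕ σj≡0))) of λ ())

lift₀-ballot : (τ : Permutation′ n) → Avoids (lift₀ τ) p321 → IsBallot (lift₀ τ)
lift₀-ballot τ avoids = ballot-criterion (lift₀ τ) first-ascent (descent⇒ascent-of-321-avoider (lift₀ τ) avoids)
  where
  first-ascent : ¬ val (lift₀ τ) 1 < val (lift₀ τ) 0
  first-ascent desc = n≮0 (subst (val (lift₀ τ) 1 <_) (val-toℕ (lift₀ τ) 0F) desc)

contains-lift₀⁺ : {τ : Permutation′ n} {π : Permutation′ k} → Contains τ π → Contains (lift₀ τ) π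
contains-lift₀⁺ {τ = τ} {π} (c , increasing , iso) =
  contains-of-order (lift₀ τ) π (λ i → Fin.suc (c i)) (λ i j i<j → s≤s (increasing i j i<j))
    (λ i j π< → s≤s (Equivalence.to (iso i j) π<))

-- An occurrence in lift₀ τ of a pattern that does not start with its minimum cannot
-- use the new initial minimum.
contains-lift₀⁻ : {τ : Permutation′ n} {π : Permutation′ (suc k)} (j : Fin (suc k)) →
  value π j < value π 0F → Contains (lift₀ τ) π → Contains τ π
contains-lift₀⁻ {n} {k} {τ} {π} j πj<π0 (c , increasing , iso) = contains-of-order τ π c′ increasing′ order′
  where
  c0≢0 : 0F ≢ c 0F
  c0≢0 e = n≮0 (subst (λ x → value (lift₀ τ) (c j) < value (lift₀ τ) x) (sym e) (Equivalence.to (iso j 0F) πj<π0))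
  c≢0 : ∀ i → 0F ≢ c i
  c≢0 0F = c0≢0
  c≢0 (Fin.suc i) e = n≮0 (subst (λ x → toℕ (c 0F) < toℕ x) (sym e) (increasing 0F (Fin.suc i) (s≤s z≤n)))
  c′ : Fin (suc k) → Fin n
  c′ i = punchOut (c≢0 i)
  c≡suc-c′ : ∀ i → c i ≡ Fin.suc (c′ i)
  c≡suc-c′ i = sym (punchIn-punchOut (c≢0 i))
  increasing′ : ∀ i i′ → toℕ i < toℕ i′ → toℕ (c′ i) < toℕ (c′ i′)
  increasing′ i i′ i<i′ =
    s<s⁻¹ (subst₂ _<_ (cong toℕ (c≡suc-c′ i)) (cong toℕ (c≡suc-c′ i′)) (increasing i i′ i<i′))
  order′ : ∀ i i′ → value π i < value π i′ → value τ (c′ i) < value τ (c′ i′)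
  order′ i i′ π< = s<s⁻¹ (subst₂ _<_ (cong (value (lift₀ τ)) (c≡suc-c′ i)) (cong (value (lift₀ τ)) (c≡suc-c′ i′))
                                      (Equivalence.to (iso i i′) π<))

remove₀-avoids : (σ : Permutation′ (suc n)) → σ ⟨$⟩ʳ 0F ≡ 0F →
  (π : Permutation′ k) → Avoids σ π → Avoids (remove 0F σ) π
remove₀-avoids σ σ0≡0 π avoids occ =
  avoids (contains-resp-≈ {ρ = lift₀ (remove 0F σ)} {σ} {π} (lift₀-remove σ σ0≡0)
                          (contains-lift₀⁺ {τ = remove 0F σ} {π} occ))

lift₀-avoids : (τ : Permutation′ n) (π : Permutation′ (suc k)) (j : Fin (suc k)) →
  value π j < value π 0F → Avoids τ π → Avoids (lift₀ τ) π
lift₀-avoids τ π j πj<π0 avoids occ = avoids (contains-lift₀⁻ {τ = τ} {π} j πj<π0 occ)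

remove₀-cong : (σ σ′ : Permutation′ (suc n)) → σ ⟨$⟩ʳ 0F ≡ 0F → σ′ ⟨$⟩ʳ 0F ≡ 0F →
  σ ≈ σ′ → remove 0F σ ≈ remove 0F σ′
remove₀-cong σ σ′ σ0≡0 σ′0≡0 σ≈σ′ i = suc-injective (begin
  Fin.suc (remove 0F σ ⟨$⟩ʳ i)   ≡⟨ lift₀-remove σ σ0≡0 (Fin.suc i) ⟩
  σ ⟨$⟩ʳ Fin.suc i               ≡⟨ σ≈σ′ (Fin.suc i) ⟩
  σ′ ⟨$⟩ʳ Fin.suc i              ≡⟨ sym (lift₀-remove σ′ σ′0≡0 (Fin.suc i)) ⟩
  Fin.suc (remove 0F σ′ ⟨$⟩ʳ i)  ∎)
  where open ≡-Reasoning

theorem3p13 : (n : ℕ) → 1 ≤ n →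
    Bijection {suc n} {n}
    (λ (σ : Permutation′ (suc n)) → IsBallot σ × (Avoids σ p231 × Avoids σ p321))
    (λ (σ : Permutation′ n) → Avoids σ p231 × Avoids σ p321)
theorem3p13 zero ()
theorem3p13 (suc n) _ = record
  { to        = λ x@(σ , _ , avoids₂₃₁ , avoids₃₂₁) →
                  remove 0F σ , remove₀-avoids σ (starts-at-0 x) p231 avoids₂₃₁ ,
                  remove₀-avoids σ (starts-at-0 x) p321 avoids₃₂₁
  ; from      = λ (τ , avoids₂₃₁ , avoids₃₂₁) →
                  lift₀ τ , lift₀-ballot τ (lift₀-avoids τ p321 2F (s≤s z≤n) avoids₃₂₁) ,
                  lift₀-avoids τ p231 2F (s≤s z≤n) avoids₂₃₁ , lift₀-avoids τ p321 2F (s≤s z≤n) avoids₃₂₁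
  ; to-cong   = λ {x} {y} → remove₀-cong (proj₁ x) (proj₁ y) (starts-at-0 x) (starts-at-0 y)
  ; from-cong = λ {τ} {τ′} → lift₀-cong (proj₁ τ) (proj₁ τ′)
  ; from∘to   = λ x → lift₀-remove (proj₁ x) (starts-at-0 x)
  ; to∘from   = λ _ _ → refl
  }
  where
  starts-at-0 : (x : B-231-321 (suc (suc n))) → proj₁ x ⟨$⟩ʳ 0F ≡ 0F
  starts-at-0 (σ , ballot , avoids₂₃₁ , _) =
    first-ascent-231-avoider-starts-at-0 σ (ballot⇒first-ascent σ ballot) avoids₂₃₁
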